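{- Given a CLR instance with facilities $F$, clients $C$, opening costs $f$, facility capacities $u$, demands $d$, vehicle capacity $\bar{u}$ and metric $c$, consider the CFL instance with the same clients, facilities, demands, opening costs and facility capacities, but with distances $\tilde{c} := \frac{2c}{\bar{u}}$. Let $(\tilde{F}, \tilde{x})$ be an optimal solution to this CFL instance. Then $\sum_{w \in \tilde{F}} \big(f(w) + \sum_{v \in C} \tilde{c}(v,w)\tilde{x}(v,w)\big) \leq \operatorname{OPT}$, where $\operatorname{OPT}$ is the optimal cost of the CLR instance.
   Context: A CLR instance consists of a finite set $F$ of facilities, a finite set $C$ of clients, opening costs $f(w) \geq 0$ and capacities $u(w) \in \mathbb{Z}_+$ for $w \in F$, demands $d(v) \in \mathbb{Z}_+$ for $v \in C$, a uniform vehicle capacity $\bar{u} \in \mathbb{Z}_+$, and a metric $c : V \times V \to \mathbb{R}_+$ on $V := F \cup C$. A tour $T$ consists of a facility $w_T$, a sequence of clients $v_T^1, \dots, v_T^k$, and service values $x_T(v) \geq 0$ for $v \in C$ with $x_T(v) = 0$ for clients not in the sequence; its cost is $c(T) = c(w_T, v_T^1) + \sum_{i=1}^{k-1} c(v_T^i, v_T^{i+1}) + c(v_T^k, w_T)$. A feasible CLR solution is a pair $(F', \mathcal{T})$ with $F' \subseteq F$ and tours $\mathcal{T}$ with $w_T \in F'$ for all $T$, $\sum_{T} x_T(v) = d(v)$ for all $v \in C$, $\sum_{v \in C} x_T(v) \leq \bar{u}$ for all $T$, and $\sum_{T: w_T = w} \sum_{v \in C} x_T(v) \leq u(w)$ for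 all $w \in F$; its cost is $\sum_{w \in F'} f(w) + \sum_{T \in \mathcal{T}} c(T)$, and $\operatorname{OPT}$ is the minimum cost. A CFL solution for facilities $F$, clients $C$, costs $f$, capacities $u$, demands $d$ and distance $\tilde c$ is a set $\tilde F \subseteq F$ with values $\tilde x(v,w) \geq 0$ ($v \in C$, $w \in \tilde F$) such that $\sum_{w \in \tilde F} \tilde x(v,w) = d(v)$ for all $v$ and $\sum_{v} \tilde x(v,w) \leq u(w)$ for all $w$; its cost is $\sum_{w \in \tilde F} f(w) + \sum_{v,w} \tilde c(v,w)\tilde x(v,w)$.
   Formalization: The metric c, the opening costs f, the service values $x_T(v)$ of the tours and the CFL values $\tilde{x}$ are rational rather than real. -}

module Defs where

open import Data.Nat as ℕ using (ℕ; zero; suc)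
open import Data.Integer using (+_)
open import Data.Rational using (ℚ; 0ℚ; _+_; _*_; _≤_; _/_)
open import Data.Fin using (Fin; zero; suc; _≟_)
open import Data.Bool using (Bool; true; false; if_then_else_)
open import Data.List using (List; []; _∷_; map; _++_; [_])
open import Data.List.Membership.Propositional using (_∈_; _∉_)
open import Data.Sum using (_⊎_; inj₁; inj₂)
open import Data.Product using (_×_)
open import Relation.Binary.PropositionalEquality using (_≡_)
open import Relation.Nullary.Decidable using (⌊_⌋)

ι : ℕ → ℚ
ι n = + n / 1

ΣFin : (n : ℕ) → (Fin n → ℚ) → ℚ
ΣFin zero    g = 0ℚ
ΣFin (suc n) g = g zero + ΣFin n (λ i → g (suc i))

ΣList : {A : Set} → List A → (A → ℚ) → ℚ
ΣList []       g = 0ℚ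
ΣList (a ∷ as) g = g a + ΣList as g

record CLRInstance : Set where
  field
    nF nC : ℕ
    f     : Fin nF → ℚ
    f≥0   : ∀ w → 0ℚ ≤ f w
    u     : Fin nF → ℕ
    d     : Fin nC → ℕ
    ū     : ℕ
    ū≢0   : ℕ.NonZero ū
    c     : (Fin nF ⊎ Fin nC) → (Fin nF ⊎ Fin nC) → ℚ
    c≥0     : ∀ a b → 0ℚ ≤ c a b
    c-refl  : ∀ a → c a a ≡ 0ℚ
    c-sym   : ∀ a b → c a b ≡ c b a
    c-tri   : ∀ a b e → c a e ≤ c a b + c b e

module _ (I : CLRInstance) where
  open CLRInstance I

  V : Set
  V = Fin nF ⊎ Fin nC

  c̃ : Fin nC → Fin nF → ℚ
  c̃ v w = ((+ 2 / ū) {{ū≢0}}) * c (inj₂ v) (inj₁ w)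

  -- a tour: facility, sequence of clients, service values
  record Tour : Set where
    field
      fac : Fin nF
      seq : List (Fin nC)
      x   : Fin nC → ℚ

  open Tour public

  ValidTour : Tour → Set
  ValidTour T = (∀ v → 0ℚ ≤ x T v) × (∀ v → v ∉ seq T → x T v ≡ 0ℚ)

  walkCost : List V → ℚ
  walkCost (a ∷ b ∷ r) = c a b + walkCost (b ∷ r)
  walkCost _           = 0ℚ

  tourCost : Tour → ℚ
  tourCost T = walkCost (inj₁ (fac T) ∷ map inj₂ (seq T) ++ [ inj₁ (fac T) ])

  load : Tour → ℚ
  load T = ΣFin nC (x T)

  facLoad : List Tour → Fin nF → ℚ
  facLoad Ts w = ΣList Ts (λ T → if ⌊ fac T ≟ w ⌋ then load T else 0ℚ)

  openCost : (Fin nF → Bool) → ℚ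
  openCost F′ = ΣFin nF (λ w → if F′ w then f w else 0ℚ)

  CLRFeasible : (Fin nF → Bool) → List Tour → Set
  CLRFeasible F′ Ts =
      (∀ T → T ∈ Ts → ValidTour T)
    × (∀ T → T ∈ Ts → F′ (fac T) ≡ true)
    × (∀ v → ΣList Ts (λ T → x T v) ≡ ι (d v))
    × (∀ T → T ∈ Ts → load T ≤ ι ū)
    × (∀ w → facLoad Ts w ≤ ι (u w))

  CLRCost : (Fin nF → Bool) → List Tour → ℚ
  CLRCost F′ Ts = openCost F′ + ΣList Ts tourCost

  -- CFL solution (F̃, x̃) for distances c̃; x̃(v,w) is only defined for w ∈ F̃,
  -- encoded by requiring x̃(v,w) = 0 for w ∉ F̃.
  CFLSolution : (Fin nF → Bool) → (Fin nC → Fin nF → ℚ) → Set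
  CFLSolution F̃ x̃ =
      (∀ v w → 0ℚ ≤ x̃ v w)
    × (∀ v w → F̃ w ≡ false → x̃ v w ≡ 0ℚ)
    × (∀ v → ΣFin nF (λ w → if F̃ w then x̃ v w else 0ℚ) ≡ ι (d v))
    × (∀ w → F̃ w ≡ true → ΣFin nC (λ v → x̃ v w) ≤ ι (u w))

  CFLCost : (Fin nF → Bool) → (Fin nC → Fin nF → ℚ) → ℚ
  CFLCost F̃ x̃ = openCost F̃
    + ΣFin nF (λ w → if F̃ w then ΣFin nC (λ v → c̃ v w * x̃ v w) else 0ℚ)

  CFLOptimal : (Fin nF → Bool) → (Fin nC → Fin nF → ℚ) → Set
  CFLOptimal F̃ x̃ = CFLSolution F̃ x̃
    × (∀ F̃′ x̃′ → CFLSolution F̃′ x̃′ → CFLCost F̃ x̃ ≤ CFLCost F̃′ x̃′)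

  lhsSum : (Fin nF → Bool) → (Fin nC → Fin nF → ℚ) → ℚ
  lhsSum F̃ x̃ = ΣFin nF (λ w → if F̃ w then f w + ΣFin nC (λ v → c̃ v w * x̃ v w) else 0ℚ)

{-# OPTIONS --safe #-}
module Submission where

-- A tour T from facility w that serves client v passes through v, so by the
-- triangle inequality c(T) ≥ 2 c(v, w).  Weighting by the service values and
-- using load(T) ≤ ū gives Σ_v c̃(v, w) x_T(v) ≤ (c(T) / ū) · load(T) ≤ c(T).
-- Hence sending to each client v, from each facility w, the amount that the
-- tours based at w deliver to v is a CFL solution on the same open facilities
-- whose cost is at most the CLR cost, and optimality of (F̃, x̃) concludes.

open import Defs
open import Algebra.Bundles using (CommutativeMonoid)
open import Data.Bool using (Bool; true; false; if_then_else_)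
open import Data.Fin using (Fin; zero; suc; _≟_)
import Data.Integer as ℤ using (+_)
open import Data.Integer.Properties using () renaming (*-assoc to ℤ-*-assoc)
open import Data.List using (List; []; _∷_; map; _++_; [_])
open import Data.List.Membership.Propositional using (_∈_)
open import Data.List.Membership.Propositional.Properties using (∈-map⁺)
open import Data.List.Relation.Unary.Any using (here; there)
open import Data.Nat as ℕ using (zero; suc)
open import Data.Product using (_,_; proj₁)
open import Data.Rational using (ℚ; _≤_; 0ℚ; _+_; _*_; _/_; toℚᵘ; NonNegative; nonNegative)
open import Data.Rational.Properties
  using (≤-refl; ≤-trans; ≤-reflexive; +-mono-≤; +-monoʳ-≤; +-identityˡ; +-identityʳ;
         *-zeroʳ; *-distribˡ-+; *-comm; +-assoc; +-0-commutativeMonoid;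
         *-monoˡ-≤-nonNeg; *-monoʳ-≤-nonNeg; *-cancelˡ-≤-pos;
         normalize-nonNeg; toℚᵘ-injective; toℚᵘ-homo-*; toℚᵘ-fromℚᵘ; module ≤-Reasoning)
open import Data.Rational.Solver using (module +-*-Solver)
import Data.Rational.Unnormalised as ℚᵘ
import Data.Rational.Unnormalised.Properties as ℚᵘ
open import Data.Sum using (inj₁; inj₂)
open import Relation.Binary.PropositionalEquality
  using (_≡_; refl; sym; trans; cong; cong₂; module ≡-Reasoning)
open import Relation.Nullary using (yes; no)
open import Relation.Nullary.Decidable using (⌊_⌋; ⌊⌋-map′)

open import Algebra.Properties.CommutativeSemigroup
  (CommutativeMonoid.commutativeSemigroup +-0-commutativeMonoid) using (interchange)

i/n*n≡i/1 : ∀ i n {{_ : ℕ.NonZero n}} → (i / n) * ι n ≡ i / 1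
i/n*n≡i/1 i (suc m) = toℚᵘ-injective (begin
    toℚᵘ ((i / suc m) * ι (suc m))          ≈⟨ toℚᵘ-homo-* (i / suc m) (ι (suc m)) ⟩
    toℚᵘ (i / suc m) ℚᵘ.* toℚᵘ (ι (suc m))  ≈⟨ ℚᵘ.*-cong (toℚᵘ-fromℚᵘ (ℚᵘ.mkℚᵘ i m))
                                                           (toℚᵘ-fromℚᵘ (ℚᵘ.mkℚᵘ (ℤ.+ suc m) 0)) ⟩
    ℚᵘ.mkℚᵘ i m ℚᵘ.* ℚᵘ.mkℚᵘ (ℤ.+ suc m) 0  ≈⟨ ℚᵘ.*≡* (ℤ-*-assoc i (ℤ.+ suc m) (ℤ.+ 1)) ⟩
    ℚᵘ.mkℚᵘ i 0                             ≈⟨ toℚᵘ-fromℚᵘ (ℚᵘ.mkℚᵘ i 0) ⟨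
    toℚᵘ (i / 1)                            ∎)
  where open ℚᵘ.≃-Reasoning

if-nonNeg : ∀ b {a} → 0ℚ ≤ a → 0ℚ ≤ (if b then a else 0ℚ)
if-nonNeg true  0≤a = 0≤a
if-nonNeg false _   = ≤-refl

if-distrib-+ : ∀ b a a′ → (if b then a + a′ else 0ℚ) ≡ (if b then a else 0ℚ) + (if b then a′ else 0ℚ)
if-distrib-+ true  a a′ = refl
if-distrib-+ false a a′ = refl

*-distribˡ-if : ∀ k b a → k * (if b then a else 0ℚ) ≡ (if b then k * a else 0ℚ)
*-distribˡ-if k true  a = refl
*-distribˡ-if k false a = *-zeroʳ k

if-redundant : ∀ b {a} → (b ≡ false → a ≡ 0ℚ) → (if b then a else 0ℚ) ≡ a
if-redundant true  _   = refl
if-redundant false a≡0 = sym (a≡0 refl)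

ΣFin-cong : ∀ n {g h : Fin n → ℚ} → (∀ i → g i ≡ h i) → ΣFin n g ≡ ΣFin n h
ΣFin-cong zero    g≡h = refl
ΣFin-cong (suc n) g≡h = cong₂ _+_ (g≡h zero) (ΣFin-cong n (λ i → g≡h (suc i)))

ΣFin-mono : ∀ n {g h : Fin n → ℚ} → (∀ i → g i ≤ h i) → ΣFin n g ≤ ΣFin n h
ΣFin-mono zero    g≤h = ≤-refl
ΣFin-mono (suc n) g≤h = +-mono-≤ (g≤h zero) (ΣFin-mono n (λ i → g≤h (suc i)))

ΣFin-zero : ∀ n → ΣFin n (λ _ → 0ℚ) ≡ 0ℚ
ΣFin-zero zero    = refl
ΣFin-zero (suc n) = trans (+-identityˡ _) (ΣFin-zero n)

ΣFin-distrib-+ : ∀ n (g h : Fin n → ℚ) → ΣFin n (λ i → g i + h i) ≡ ΣFin n g + ΣFin n h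
ΣFin-distrib-+ zero    g h = refl
ΣFin-distrib-+ (suc n) g h =
  trans (cong (g zero + h zero +_) (ΣFin-distrib-+ n (λ i → g (suc i)) (λ i → h (suc i))))
        (interchange (g zero) (h zero) (ΣFin n (λ i → g (suc i))) (ΣFin n (λ i → h (suc i))))

*-distribˡ-ΣFin : ∀ n k (g : Fin n → ℚ) → k * ΣFin n g ≡ ΣFin n (λ i → k * g i)
*-distribˡ-ΣFin zero    k g = *-zeroʳ k
*-distribˡ-ΣFin (suc n) k g =
  trans (*-distribˡ-+ k (g zero) _) (cong (k * g zero +_) (*-distribˡ-ΣFin n k (λ i → g (suc i))))

ΣFin-if : ∀ n b (g : Fin n → ℚ) → ΣFin n (λ i → if b then g i else 0ℚ) ≡ (if b then ΣFin n g else 0ℚ)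
ΣFin-if n true  g = refl
ΣFin-if n false g = ΣFin-zero n

ΣFin-δ : ∀ n (j : Fin n) (g : Fin n → ℚ) → ΣFin n (λ i → if ⌊ j ≟ i ⌋ then g i else 0ℚ) ≡ g j
ΣFin-δ (suc n) zero    g = trans (cong (g zero +_) (ΣFin-zero n)) (+-identityʳ (g zero))
ΣFin-δ (suc n) (suc j) g = begin
  0ℚ + ΣFin n (λ i → if ⌊ suc j ≟ suc i ⌋ then g (suc i) else 0ℚ)
    ≡⟨ +-identityˡ _ ⟩
  ΣFin n (λ i → if ⌊ suc j ≟ suc i ⌋ then g (suc i) else 0ℚ)
    ≡⟨ ΣFin-cong n (λ i → cong (λ b → if b then g (suc i) else 0ℚ) (⌊⌋-map′ _ _ (j ≟ i))) ⟩
  ΣFin n (λ i → if ⌊ j ≟ i ⌋ then g (suc i) else 0ℚ)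
    ≡⟨ ΣFin-δ n j (λ i → g (suc i)) ⟩
  g (suc j) ∎
  where open ≡-Reasoning

module _ {A : Set} where

  ΣList-cong : ∀ (as : List A) {g h : A → ℚ} → (∀ a → a ∈ as → g a ≡ h a) → ΣList as g ≡ ΣList as h
  ΣList-cong []       g≡h = refl
  ΣList-cong (a ∷ as) g≡h = cong₂ _+_ (g≡h a (here refl)) (ΣList-cong as (λ b b∈as → g≡h b (there b∈as)))

  ΣList-mono : ∀ (as : List A) {g h : A → ℚ} → (∀ a → a ∈ as → g a ≤ h a) → ΣList as g ≤ ΣList as h
  ΣList-mono []       g≤h = ≤-refl
  ΣList-mono (a ∷ as) g≤h = +-mono-≤ (g≤h a (here refl)) (ΣList-mono as (λ b b∈as → g≤h b (there b∈as)))

  ΣList-zero : ∀ (as : List A) → ΣList as (λ _ → 0ℚ) ≡ 0ℚ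
  ΣList-zero []       = refl
  ΣList-zero (a ∷ as) = trans (+-identityˡ _) (ΣList-zero as)

  *-distribˡ-ΣList : ∀ (as : List A) k (g : A → ℚ) → k * ΣList as g ≡ ΣList as (λ a → k * g a)
  *-distribˡ-ΣList []       k g = *-zeroʳ k
  *-distribˡ-ΣList (a ∷ as) k g = trans (*-distribˡ-+ k (g a) _) (cong (k * g a +_) (*-distribˡ-ΣList as k g))

  ΣFin-ΣList-comm : ∀ n (as : List A) (g : A → Fin n → ℚ) →
    ΣFin n (λ i → ΣList as (λ a → g a i)) ≡ ΣList as (λ a → ΣFin n (g a))
  ΣFin-ΣList-comm n []       g = ΣFin-zero n
  ΣFin-ΣList-comm n (a ∷ as) g =
    trans (ΣFin-distrib-+ n (g a) _) (cong (ΣFin n (g a) +_) (ΣFin-ΣList-comm n as g))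

module _ (I : CLRInstance) where
  open CLRInstance I
  open import Data.List.Membership.DecPropositional (_≟_ {nC}) using (_∈?_)

  walkCost-nonNeg : ∀ ps → 0ℚ ≤ walkCost I ps
  walkCost-nonNeg []           = ≤-refl
  walkCost-nonNeg (a ∷ [])     = ≤-refl
  walkCost-nonNeg (a ∷ b ∷ ps) = +-mono-≤ (c≥0 a b) (walkCost-nonNeg (b ∷ ps))

  c≤walkCost : ∀ a ps b → c a b ≤ walkCost I (a ∷ ps ++ [ b ])
  c≤walkCost a []       b = ≤-reflexive (sym (+-identityʳ (c a b)))
  c≤walkCost a (p ∷ ps) b = ≤-trans (c-tri a p b) (+-monoʳ-≤ (c a p) (c≤walkCost p ps b))

  detour≤walkCost : ∀ a ps b {p} → p ∈ ps → c a p + c p b ≤ walkCost I (a ∷ ps ++ [ b ])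
  detour≤walkCost a (p ∷ ps) b (here refl) = +-monoʳ-≤ (c a p) (c≤walkCost p ps b)
  detour≤walkCost a (q ∷ ps) b {p} (there p∈ps) = begin
    c a p + c p b                    ≤⟨ +-mono-≤ (c-tri a q p) ≤-refl ⟩
    c a q + c q p + c p b            ≡⟨ +-assoc (c a q) (c q p) (c p b) ⟩
    c a q + (c q p + c p b)          ≤⟨ +-monoʳ-≤ (c a q) (detour≤walkCost q ps b p∈ps) ⟩
    walkCost I (a ∷ q ∷ ps ++ [ b ]) ∎
    where open ≤-Reasoning

  2/ū : ℚ
  2/ū = (ℤ.+ 2 / ū) {{ū≢0}}

  2/ū-nonNeg : NonNegative 2/ū
  2/ū-nonNeg = normalize-nonNeg 2 ū {{ū≢0}}

  radialCost : Tour I → ℚ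
  radialCost T = ΣFin nC (λ v → c̃ I v (fac T) * x T v)

  roundTrip≤tourCost : ∀ T {v} → v ∈ seq T → ι 2 * c (inj₂ v) (inj₁ (fac T)) ≤ tourCost I T
  roundTrip≤tourCost T {v} v∈T = begin
    ι 2 * c v′ w    ≡⟨ double (c v′ w) ⟩
    c v′ w + c v′ w ≡⟨ cong (_+ c v′ w) (c-sym v′ w) ⟩
    c w v′ + c v′ w ≤⟨ detour≤walkCost w (map inj₂ (seq T)) w (∈-map⁺ inj₂ v∈T) ⟩
    tourCost I T    ∎
    where
    open ≤-Reasoning
    open +-*-Solver
    v′ w : V I
    v′ = inj₂ v
    w = inj₁ (fac T)
    double : ∀ a → ι 2 * a ≡ a + a
    double = solve 1 (λ a → con (ι 2) :* a := a :+ a) refl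

  weighted-roundTrip≤tourCost : ∀ T → ValidTour I T → ∀ v →
    ι 2 * c (inj₂ v) (inj₁ (fac T)) * x T v ≤ tourCost I T * x T v
  weighted-roundTrip≤tourCost T (x≥0 , x≡0) v with v ∈? seq T
  ... | yes v∈T = *-monoʳ-≤-nonNeg (x T v) {{nonNegative (x≥0 v)}} (roundTrip≤tourCost T v∈T)
  ... | no  v∉T rewrite x≡0 v v∉T =
    ≤-reflexive (trans (*-zeroʳ (ι 2 * c (inj₂ v) (inj₁ (fac T)))) (sym (*-zeroʳ (tourCost I T))))

  radialCost≤tourCost : ∀ T → ValidTour I T → load I T ≤ ι ū → radialCost T ≤ tourCost I T
  -- Bound 2 · radialCost T, so that the round trip 2 c(v, w) ≤ c(T) is used without halving.
  radialCost≤tourCost T valid load≤ū = *-cancelˡ-≤-pos (ι 2) (begin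
    ι 2 * radialCost T
      ≡⟨ *-distribˡ-ΣFin nC (ι 2) _ ⟩
    ΣFin nC (λ v → ι 2 * (2/ū * cw v * x T v))
      ≡⟨ ΣFin-cong nC (λ v → regroup (ι 2) 2/ū (cw v) (x T v)) ⟩
    ΣFin nC (λ v → 2/ū * (ι 2 * cw v * x T v))
      ≤⟨ ΣFin-mono nC (λ v → *-monoˡ-≤-nonNeg 2/ū {{2/ū-nonNeg}} (weighted-roundTrip≤tourCost T valid v)) ⟩
    ΣFin nC (λ v → 2/ū * (t * x T v))
      ≡⟨ *-distribˡ-ΣFin nC 2/ū _ ⟨
    2/ū * ΣFin nC (λ v → t * x T v)
      ≡⟨ cong (2/ū *_) (*-distribˡ-ΣFin nC t (x T)) ⟨
    2/ū * (t * load I T)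
      ≤⟨ *-monoˡ-≤-nonNeg 2/ū {{2/ū-nonNeg}} (*-monoˡ-≤-nonNeg t {{t-nonNeg}} load≤ū) ⟩
    2/ū * (t * ι ū)
      ≡⟨ swap 2/ū t (ι ū) ⟩
    t * (2/ū * ι ū)
      ≡⟨ cong (t *_) (i/n*n≡i/1 (ℤ.+ 2) ū {{ū≢0}}) ⟩
    t * ι 2
      ≡⟨ *-comm t (ι 2) ⟩
    ι 2 * t ∎)
    where
    open ≤-Reasoning
    open +-*-Solver
    t : ℚ
    t = tourCost I T
    cw : Fin nC → ℚ
    cw v = c (inj₂ v) (inj₁ (fac T))
    t-nonNeg : NonNegative t
    t-nonNeg = nonNegative (walkCost-nonNeg (inj₁ (fac T) ∷ map inj₂ (seq T) ++ [ inj₁ (fac T) ]))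
    regroup : ∀ a k y z → a * (k * y * z) ≡ k * (a * y * z)
    regroup = solve 4 (λ a k y z → a :* (k :* y :* z) := k :* (a :* y :* z)) refl
    swap : ∀ a b z → a * (b * z) ≡ b * (a * z)
    swap = solve 3 (λ a b z → a :* (b :* z) := b :* (a :* z)) refl

  deliveredBy : Tour I → Fin nC → Fin nF → ℚ
  deliveredBy T v w = if ⌊ fac T ≟ w ⌋ then x T v else 0ℚ

  delivered : List (Tour I) → Fin nC → Fin nF → ℚ
  delivered Ts v w = ΣList Ts (λ T → deliveredBy T v w)

  connectionCost : (Fin nF → Bool) → (Fin nC → Fin nF → ℚ) → ℚ
  connectionCost F y = ΣFin nF (λ w → if F w then ΣFin nC (λ v → c̃ I v w * y v w) else 0ℚ)

  connectionCost-unguarded : ∀ F y → (∀ v w → F w ≡ false → y v w ≡ 0ℚ) →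
    connectionCost F y ≡ ΣFin nF (λ w → ΣFin nC (λ v → c̃ I v w * y v w))
  connectionCost-unguarded F y y≡0 = ΣFin-cong nF (λ w → if-redundant (F w) (λ Fw≡false →
    trans (ΣFin-cong nC (λ v → trans (cong (c̃ I v w *_) (y≡0 v w Fw≡false)) (*-zeroʳ (c̃ I v w))))
          (ΣFin-zero nC)))

  lhsSum≡CFLCost : ∀ F y → lhsSum I F y ≡ CFLCost I F y
  lhsSum≡CFLCost F y = trans (ΣFin-cong nF (λ w → if-distrib-+ (F w) (f w) _))
                             (ΣFin-distrib-+ nF _ _)

  Σ-delivered-facilities : ∀ Ts v → ΣFin nF (delivered Ts v) ≡ ΣList Ts (λ T → x T v)
  Σ-delivered-facilities Ts v =
    trans (ΣFin-ΣList-comm nF Ts (λ T → deliveredBy T v))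
          (ΣList-cong Ts (λ T _ → ΣFin-δ nF (fac T) (λ _ → x T v)))

  Σ-delivered-clients : ∀ Ts w → ΣFin nC (λ v → delivered Ts v w) ≡ facLoad I Ts w
  Σ-delivered-clients Ts w =
    trans (ΣFin-ΣList-comm nC Ts (λ T v → deliveredBy T v w))
          (ΣList-cong Ts (λ T _ → ΣFin-if nC ⌊ fac T ≟ w ⌋ (x T)))

  Σ-c̃-deliveredBy : ∀ T → ΣFin nF (λ w → ΣFin nC (λ v → c̃ I v w * deliveredBy T v w)) ≡ radialCost T
  Σ-c̃-deliveredBy T = begin
    ΣFin nF (λ w → ΣFin nC (λ v → c̃ I v w * deliveredBy T v w))
      ≡⟨ ΣFin-cong nF (λ w → ΣFin-cong nC (λ v → *-distribˡ-if (c̃ I v w) ⌊ fac T ≟ w ⌋ (x T v))) ⟩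
    ΣFin nF (λ w → ΣFin nC (λ v → if ⌊ fac T ≟ w ⌋ then c̃ I v w * x T v else 0ℚ))
      ≡⟨ ΣFin-cong nF (λ w → ΣFin-if nC ⌊ fac T ≟ w ⌋ (λ v → c̃ I v w * x T v)) ⟩
    ΣFin nF (λ w → if ⌊ fac T ≟ w ⌋ then ΣFin nC (λ v → c̃ I v w * x T v) else 0ℚ)
      ≡⟨ ΣFin-δ nF (fac T) (λ w → ΣFin nC (λ v → c̃ I v w * x T v)) ⟩
    radialCost T ∎
    where open ≡-Reasoning

  Σ-c̃-delivered : ∀ Ts → ΣFin nF (λ w → ΣFin nC (λ v → c̃ I v w * delivered Ts v w)) ≡ ΣList Ts radialCost
  Σ-c̃-delivered Ts = begin
    ΣFin nF (λ w → ΣFin nC (λ v → c̃ I v w * delivered Ts v w))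
      ≡⟨ ΣFin-cong nF (λ w → ΣFin-cong nC (λ v → *-distribˡ-ΣList Ts (c̃ I v w) (λ T → deliveredBy T v w))) ⟩
    ΣFin nF (λ w → ΣFin nC (λ v → ΣList Ts (λ T → c̃ I v w * deliveredBy T v w)))
      ≡⟨ ΣFin-cong nF (λ w → ΣFin-ΣList-comm nC Ts (λ T v → c̃ I v w * deliveredBy T v w)) ⟩
    ΣFin nF (λ w → ΣList Ts (λ T → ΣFin nC (λ v → c̃ I v w * deliveredBy T v w)))
      ≡⟨ ΣFin-ΣList-comm nF Ts (λ T w → ΣFin nC (λ v → c̃ I v w * deliveredBy T v w)) ⟩
    ΣList Ts (λ T → ΣFin nF (λ w → ΣFin nC (λ v → c̃ I v w * deliveredBy T v w)))
      ≡⟨ ΣList-cong Ts (λ T _ → Σ-c̃-deliveredBy T) ⟩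
    ΣList Ts radialCost ∎
    where open ≡-Reasoning

  delivered-closed : ∀ (F′ : Fin nF → Bool) {Ts} → (∀ T → T ∈ Ts → F′ (fac T) ≡ true) →
    ∀ v w → F′ w ≡ false → delivered Ts v w ≡ 0ℚ
  delivered-closed F′ {Ts} atOpen v w F′w≡false = trans (ΣList-cong Ts fromClosed) (ΣList-zero Ts)
    where
    fromClosed : ∀ T → T ∈ Ts → deliveredBy T v w ≡ 0ℚ
    fromClosed T T∈Ts with fac T ≟ w
    ... | yes refl with () ← trans (sym (atOpen T T∈Ts)) F′w≡false
    ... | no _     = refl

  delivered-nonNeg : ∀ {Ts} → (∀ T → T ∈ Ts → ValidTour I T) → ∀ v w → 0ℚ ≤ delivered Ts v w
  delivered-nonNeg {Ts} valid v w = ≤-trans (≤-reflexive (sym (ΣList-zero Ts)))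
    (ΣList-mono Ts (λ T T∈Ts → if-nonNeg ⌊ fac T ≟ w ⌋ (proj₁ (valid T T∈Ts) v)))

  delivered-CFLSolution : ∀ {F′ Ts} → CLRFeasible I F′ Ts → CFLSolution I F′ (delivered Ts)
  delivered-CFLSolution {F′} {Ts} (valid , atOpen , demand , _ , facilityCap) =
      delivered-nonNeg valid
    , delivered-closed F′ atOpen
    , (λ v → trans (ΣFin-cong nF (λ w → if-redundant (F′ w) (delivered-closed F′ atOpen v w)))
                   (trans (Σ-delivered-facilities Ts v) (demand v)))
    , (λ w _ → ≤-trans (≤-reflexive (Σ-delivered-clients Ts w)) (facilityCap w))

  delivered-CFLCost≤CLRCost : ∀ {F′ Ts} → CLRFeasible I F′ Ts → CFLCost I F′ (delivered Ts) ≤ CLRCost I F′ Ts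
  delivered-CFLCost≤CLRCost {F′} {Ts} (valid , atOpen , _ , vehicleCap , _) = +-monoʳ-≤ (openCost I F′) (begin
    connectionCost F′ (delivered Ts)
      ≡⟨ connectionCost-unguarded F′ (delivered Ts) (delivered-closed F′ atOpen) ⟩
    ΣFin nF (λ w → ΣFin nC (λ v → c̃ I v w * delivered Ts v w))
      ≡⟨ Σ-c̃-delivered Ts ⟩
    ΣList Ts radialCost
      ≤⟨ ΣList-mono Ts (λ T T∈Ts → radialCost≤tourCost T (valid T T∈Ts) (vehicleCap T T∈Ts)) ⟩
    ΣList Ts (tourCost I) ∎)
    where open ≤-Reasoning

lemma2 : (I : CLRInstance)
    → (F̃ : Fin (CLRInstance.nF I) → Bool)
    → (x̃ : Fin (CLRInstance.nC I) → Fin (CLRInstance.nF I) → ℚ)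
    → CFLOptimal I F̃ x̃
    → (F′ : Fin (CLRInstance.nF I) → Bool) (Ts : List (Tour I))
    → CLRFeasible I F′ Ts
    → lhsSum I F̃ x̃ ≤ CLRCost I F′ Ts
lemma2 I F̃ x̃ (_ , optimal) F′ Ts feasible = begin
  lhsSum I F̃ x̃                  ≡⟨ lhsSum≡CFLCost I F̃ x̃ ⟩
  CFLCost I F̃ x̃                 ≤⟨ optimal F′ (delivered I Ts) (delivered-CFLSolution I feasible) ⟩
  CFLCost I F′ (delivered I Ts)  ≤⟨ delivered-CFLCost≤CLRCost I feasible ⟩
  CLRCost I F′ Ts                ∎
  where open ≤-Reasoning
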